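{- Let $(G,w)$ be a weighted game graph, $B>0$ an integer, and $v$ a node with penalty $P_{G,w}(v)\ge B$. Then there is an optimal strategy $\tau^*$ of Bob such that for every strategy $\sigma$ of Alice, $e^*_{G(\sigma,\tau^*),w}(v)=\infty$ implies $e^*_{G(\sigma,\tau^*),w_B}(v)=\infty$.
   Context: A weighted game graph $(G,w)$ consists of a finite directed graph $G=(V,E)$ in which every node has out-degree at least $1$, a partition $V=V_A\cup V_B$ into nodes of Alice and of Bob, and integer edge weights $w:E\to\mathbb{Z}$. A (positional) strategy $\sigma$ of Alice picks for each $u\in V_A$ an out-neighbor $\sigma(u)$; a strategy $\tau$ of Bob picks for each $u\in V_B$ an out-neighbor $\tau(u)$. $G(\sigma,\tau)$ is the subgraph with edges $\{(u,\sigma(u)):u\in V_A\}\cup\{(u,\tau(u)):u\in V_B\}$; from any node $s$ there is a unique cycle $C$ reachable in it. For a weight function $w'$, $w'(P)$ is total weight; $e^*_{G(\sigma,\tau),w'}(s)=\infty$ if $w'(C)<0$, else $\max\{0,-\min_P w'(P)\}$ over simple paths $P$ in $G(\sigma,\tau)$ starting at $s$. The minimal energy is $e^*_{G,w}(s)=\min_\sigma\max_\tau e^*_{G(\sigma,\tau),w}(s)$. A strategy $\tau^*$ of Bob is optimal (for $s$) if $e^*_{G(\sigma,\tau^*),w}(s)\ge e^*_{G,w}(s)$ for all $\sigma$. Node $s$ has penalty at least $D\ge0$ if there is an optimal $\tau^*$ of Bob such that for every $\sigma$, the cycle $C$ reachable from $s$ in $G(\sigma,\tau^*)$ satisfies $w(C)<0\Rightarrow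 w(C)/|C|\le -D$; $P_{G,w}(s)$ is the supremum of such $D$. The rounded weight function is $w_B(u,v)=\lceil w(u,v)/B\rceil\cdot B$. -}

module Defs where

open import Data.Nat as ℕ using (ℕ; zero; suc; NonZero)
open import Data.Integer using (ℤ; +_; -_; _+_; _-_; _*_; _<_; _≤_; 0ℤ)
open import Data.Integer.DivMod using (_/ℕ_)
open import Data.Fin using (Fin)
open import Data.Bool using (Bool; true; false; if_then_else_)
open import Data.Product using (Σ; ∃; ∃-syntax; _×_; _,_)
open import Data.Sum using (_⊎_)
open import Relation.Binary.PropositionalEquality using (_≡_)

-- Weighted game graphs on the node set Fin n.
-- owner u ≡ true  : u ∈ V_A (Alice);  owner u ≡ false : u ∈ V_B (Bob).
-- Weights are given on all ordered pairs; only those on edges matter.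

record GameGraph (n : ℕ) : Set₁ where
  field
    Edge   : Fin n → Fin n → Set
    outdeg : ∀ u → ∃[ v ] Edge u v
    owner  : Fin n → Bool

Weight : ℕ → Set
Weight n = Fin n → Fin n → ℤ

-- Rounded weight function w_B(u,v) = ⌈ w(u,v) / B ⌉ · B
-- (⌈a/B⌉ = - ⌊(-a)/B⌋, and _/ℕ_ is floor division).
ceilDiv : ℤ → (B : ℕ) → .{{NonZero B}} → ℤ
ceilDiv a B = - ((- a) /ℕ B)

roundW : ∀ {n} → Weight n → (B : ℕ) → .{{NonZero B}} → Weight n
roundW w B u v = ceilDiv (w u v) B * + B

module _ {n : ℕ} (G : GameGraph n) where
  open GameGraph G

  record AliceStrategy : Set where
    field
      move  : Fin n → Fin n
      legal : ∀ u → owner u ≡ true → Edge u (move u)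

  record BobStrategy : Set where
    field
      move  : Fin n → Fin n
      legal : ∀ u → owner u ≡ false → Edge u (move u)

  -- the unique successor of each node in G(σ,τ)
  play : AliceStrategy → BobStrategy → Fin n → Fin n
  play σ τ u = if owner u then AliceStrategy.move σ u else BobStrategy.move τ u

module _ {n : ℕ} (f : Fin n → Fin n) where

  node : Fin n → ℕ → Fin n
  node s zero    = s
  node s (suc k) = f (node s k)

  pathW : Weight n → Fin n → ℕ → ℤ
  pathW w s zero    = 0ℤ
  pathW w s (suc k) = pathW w s k + w (node s k) (node s (suc k))

  -- x_0 … x_k is a simple path (all nodes distinct).  In a graph where
  -- every node has exactly one outgoing edge, the simple paths starting
  -- at s are exactly these prefixes of the walk from s.
  SimplePrefix : Fin n → ℕ → Set
  SimplePrefix s k = ∀ i j → i ℕ.≤ k → j ℕ.≤ k → node s i ≡ node s j → i ≡ j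

  -- The unique cycle C reachable from s is x_m x_{m+1} … x_{m+l-1} (back to x_m):
  -- |C| = l ≥ 1, x_{m+l} = x_m, and x_0 … x_{m+l-1} are pairwise distinct.
  CycleAt : Fin n → ℕ → ℕ → Set
  CycleAt s m l = (1 ℕ.≤ l)
                × (node s (m ℕ.+ l) ≡ node s m)
                × (∀ i j → i ℕ.< m ℕ.+ l → j ℕ.< m ℕ.+ l → node s i ≡ node s j → i ≡ j)

  cycleW : Weight n → Fin n → ℕ → ℕ → ℤ
  cycleW w s m l = pathW w s (m ℕ.+ l) - pathW w s m

data ℕ∞ : Set where
  fin : ℕ → ℕ∞
  ∞   : ℕ∞

data _≤∞_ : ℕ∞ → ℕ∞ → Set where
  fin≤fin : ∀ {a b} → a ℕ.≤ b → fin a ≤∞ fin b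
  _≤∞∞    : ∀ x → x ≤∞ ∞

module _ {n : ℕ} (f : Fin n → Fin n) where

  -- E = max{0, - min_P w'(P)} over simple paths P starting at s
  IsMaxDeficit : Weight n → Fin n → ℕ → Set
  IsMaxDeficit w s E =
      (∀ k → SimplePrefix f s k → - pathW f w s k ≤ + E)
    × (E ≡ 0 ⊎ ∃[ k ] (SimplePrefix f s k × + E ≡ - pathW f w s k))

  -- Energy f w s e  :  e*_{G(σ,τ),w}(s) = e   where f is the successor map of G(σ,τ)
  Energy : Weight n → Fin n → ℕ∞ → Set
  Energy w s e = ∃[ m ] ∃[ l ] (CycleAt f s m l ×
      ( (cycleW f w s m l < 0ℤ × e ≡ ∞)
      ⊎ (0ℤ ≤ cycleW f w s m l × ∃[ E ] (e ≡ fin E × IsMaxDeficit w s E))))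

module _ {n : ℕ} (G : GameGraph n) (w : Weight n) (s : Fin n) where

  -- e = e*_{G,w}(s) = min_σ max_τ e*_{G(σ,τ),w}(s)  (strategy sets are finite and
  -- nonempty, so min and max are attained)
  MinEnergy : ℕ∞ → Set
  MinEnergy e =
      (∃[ σ ] ∀ τ e' → Energy (play G σ τ) w s e' → e' ≤∞ e)
    × (∀ σ → ∃[ τ ] ∃[ e' ] (Energy (play G σ τ) w s e' × e ≤∞ e'))

  OptimalBob : BobStrategy G → Set
  OptimalBob τ* = ∃[ e ] (MinEnergy e ×
      ∀ σ e' → Energy (play G σ τ*) w s e' → e ≤∞ e')

  -- s has penalty at least D (D a natural number here): some optimal τ* such that
  -- every negative cycle C reachable from s in G(σ,τ*) has w(C)/|C| ≤ -D,
  -- written without division as w(C) ≤ -D·|C|.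
  PenaltyAtLeast : ℕ → Set
  PenaltyAtLeast D = ∃[ τ* ] (OptimalBob τ* ×
      ∀ σ m l → CycleAt (play G σ τ*) s m l →
        cycleW (play G σ τ*) w s m l < 0ℤ →
        cycleW (play G σ τ*) w s m l ≤ - (+ D * + l))

-- Rounding up to a multiple of B raises each edge weight by at most B - 1.
-- Along the cycle C of length l this adds at most l(B - 1), while the penalty
-- gives w(C) ≤ -B·l; so w_B(C) ≤ -l < 0 and the rounded cycle stays negative.
module Submission where

open import Defs
open import Data.Nat using (ℕ; NonZero; zero; suc; s≤s)
import Data.Nat as ℕ
import Data.Nat.Properties as ℕ
open import Data.Fin using (Fin)
open import Data.Integer
  using (ℤ; +_; -_; _+_; _-_; _*_; _<_; _≤_; 0ℤ; 1ℤ; -1ℤ; pred; +<+; -<+)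
open import Data.Integer.Properties
open import Data.Integer.DivMod using (_/ℕ_; _%ℕ_; a≡a%ℕn+[a/ℕn]*n; n%ℕd<d)
open import Data.Integer.Tactic.RingSolver using (solve-∀)
open import Data.Product using (∃-syntax; _×_; _,_)
open import Data.Sum using (inj₁; inj₂)
open import Relation.Binary.PropositionalEquality using (_≡_; refl; sym; cong; module ≡-Reasoning)

ceilDiv*≡+% : ∀ a B .{{_ : NonZero B}} → ceilDiv a B * + B ≡ a + + ((- a) %ℕ B)
ceilDiv*≡+% a B = begin
  - q * + B        ≡⟨ neg-distribˡ-* q (+ B) ⟨
  - (q * + B)      ≡⟨ shift (+ r) (q * + B) ⟩
  + r - (+ r + q * + B) ≡⟨ cong (λ t → + r - t) (a≡a%ℕn+[a/ℕn]*n (- a) B) ⟨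
  + r - - a        ≡⟨ cong (λ t → + r + t) (neg-involutive a) ⟩
  + r + a          ≡⟨ +-comm (+ r) a ⟩
  a + + r          ∎
  where
  open ≡-Reasoning
  q = (- a) /ℕ B
  r = (- a) %ℕ B
  shift : ∀ x y → - y ≡ x - (x + y)
  shift = solve-∀

ceilDiv*<+ : ∀ a B .{{_ : NonZero B}} → ceilDiv a B * + B < a + + B
ceilDiv*<+ a B = begin-strict
  ceilDiv a B * + B     ≡⟨ ceilDiv*≡+% a B ⟩
  a + + ((- a) %ℕ B)    <⟨ +-monoʳ-< a (+<+ (n%ℕd<d (- a) B)) ⟩
  a + + B               ∎
  where open ≤-Reasoning

roundW≤+pred : ∀ {n} (w : Weight n) B .{{_ : NonZero B}} u v →
               roundW w B u v ≤ w u v + pred (+ B)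
roundW≤+pred w B u v = begin
  roundW w B u v          ≤⟨ i<j⇒i≤pred[j] (ceilDiv*<+ (w u v) B) ⟩
  pred (w u v + + B)      ≡⟨ +-pred (w u v) (+ B) ⟨
  w u v + pred (+ B)      ∎
  where open ≤-Reasoning

module _ {n} (f : Fin n → Fin n) where

  node-+ : ∀ s m k → node f s (m ℕ.+ k) ≡ node f (node f s m) k
  node-+ s m zero    = cong (node f s) (ℕ.+-identityʳ m)
  node-+ s m (suc k) rewrite ℕ.+-suc m k = cong f (node-+ s m k)

  pathW-+ : ∀ (w : Weight n) s m k →
            pathW f w s (m ℕ.+ k) ≡ pathW f w s m + pathW f w (node f s m) k
  pathW-+ w s m zero rewrite ℕ.+-identityʳ m = sym (+-identityʳ (pathW f w s m))
  pathW-+ w s m (suc k) rewrite ℕ.+-suc m k = begin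
    pathW f w s (m ℕ.+ k) + w x (f x)                        ≡⟨ cong (_+ w x (f x)) (pathW-+ w s m k) ⟩
    pathW f w s m + pathW f w (node f s m) k + w x (f x)     ≡⟨ +-assoc (pathW f w s m) _ _ ⟩
    pathW f w s m + (pathW f w (node f s m) k + w x (f x))   ≡⟨ cong (λ y → pathW f w s m + (pathW f w (node f s m) k + w y (f y))) (node-+ s m k) ⟩
    pathW f w s m + pathW f w (node f s m) (suc k)           ∎
    where
    open ≡-Reasoning
    x = node f s (m ℕ.+ k)

  cycleW≡pathW : ∀ (w : Weight n) s m l → cycleW f w s m l ≡ pathW f w (node f s m) l
  cycleW≡pathW w s m l = begin
    pathW f w s (m ℕ.+ l) - pathW f w s m                      ≡⟨ cong (_- pathW f w s m) (pathW-+ w s m l) ⟩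
    pathW f w s m + pathW f w (node f s m) l - pathW f w s m   ≡⟨ cancel (pathW f w s m) _ ⟩
    pathW f w (node f s m) l                                   ∎
    where
    open ≡-Reasoning
    cancel : ∀ a b → a + b - a ≡ b
    cancel = solve-∀

  pathW-mono-≤-+ : ∀ {w′ w : Weight n} d → (∀ u v → w′ u v ≤ w u v + d) →
                   ∀ s k → pathW f w′ s k ≤ pathW f w s k + + k * d
  pathW-mono-≤-+ _ _ _ zero = ≤-refl
  pathW-mono-≤-+ {w′} {w} d w′≤w+d s (suc k) = begin
    pathW f w′ s k + w′ x (f x)                  ≤⟨ +-mono-≤ (pathW-mono-≤-+ d w′≤w+d s k) (w′≤w+d x (f x)) ⟩
    pathW f w s k + + k * d + (w x (f x) + d)    ≡⟨ regroup (pathW f w s k) (w x (f x)) (+ k) d ⟩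
    pathW f w s k + w x (f x) + + suc k * d      ∎
    where
    open ≤-Reasoning
    x = node f s k
    regroup : ∀ p e k d → p + k * d + (e + d) ≡ p + e + (1ℤ + k) * d
    regroup = solve-∀

  cycleW-roundW<0 : ∀ (w : Weight n) B .{{_ : NonZero B}} s m l → 1 ℕ.≤ l →
                    cycleW f w s m l ≤ - (+ B * + l) → cycleW f (roundW w B) s m l < 0ℤ
  cycleW-roundW<0 w B s m (suc l) (s≤s _) penalty = begin-strict
    cycleW f (roundW w B) s m (suc l)               ≡⟨ cycleW≡pathW (roundW w B) s m (suc l) ⟩
    pathW f (roundW w B) x (suc l)                  ≤⟨ pathW-mono-≤-+ (pred (+ B)) (roundW≤+pred w B) x (suc l) ⟩
    pathW f w x (suc l) + L * pred (+ B)            ≡⟨ cong (_+ L * pred (+ B)) (cycleW≡pathW w s m (suc l)) ⟨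
    cycleW f w s m (suc l) + L * pred (+ B)         ≤⟨ +-monoˡ-≤ (L * pred (+ B)) penalty ⟩
    - (+ B * L) + L * pred (+ B)                    ≡⟨ collapse (+ B) L ⟩
    - L                                             <⟨ -<+ ⟩
    0ℤ                                              ∎
    where
    open ≤-Reasoning
    x = node f s m
    L = + suc l
    -- pred i is -1ℤ + i by definition, so the solver sees through it.
    collapse : ∀ b k → - (b * k) + k * (-1ℤ + b) ≡ - k
    collapse = solve-∀

lemma11 : ∀ {n} (G : GameGraph n) (w : Weight n) (B : ℕ) .{{_ : NonZero B}} (v : Fin n) →
    PenaltyAtLeast G w v B →
    ∃[ τ* ] (OptimalBob G w v τ* ×
      ∀ σ → Energy (play G σ τ*) w v ∞ → Energy (play G σ τ*) (roundW w B) v ∞)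
lemma11 G w B v (τ* , optimal , penalty) = τ* , optimal , staysInfinite
  where
  staysInfinite : ∀ σ → Energy (play G σ τ*) w v ∞ → Energy (play G σ τ*) (roundW w B) v ∞
  staysInfinite σ (m , l , cyc@(1≤l , _) , inj₁ (negative , _)) =
    m , l , cyc , inj₁ (cycleW-roundW<0 (play G σ τ*) w B v m l 1≤l (penalty σ m l cyc negative) , refl)
  staysInfinite σ (_ , _ , _ , inj₂ (_ , _ , () , _))
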